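{- Let $\mathcal{R}$ be an LCTRS. If $s\ [\varphi]\xrightarrow{\circ}t\ [\varphi]$ (multi-step on constrained terms), then $s\delta\xrightarrow{\circ}t\delta$ (multi-step on terms) for all substitutions $\delta$ with $\delta\vDash\varphi$.
   Context: Logically constrained rewriting. Fix a many-sorted signature $\mathcal{F}=\mathcal{F}_{\mathrm{te}}\cup\mathcal{F}_{\mathrm{th}}$ (possibly infinite) and an infinite set $\mathcal{V}$ of sorted variables. For every sort $\iota$ of $\mathcal{F}_{\mathrm{th}}$ there is a non-empty set $\mathcal{V}\mathrm{al}_\iota\subseteq\mathcal{F}_{\mathrm{th}}$ of constants of sort $\iota$ (values); $\mathcal{V}\mathrm{al}=\bigcup_\iota\mathcal{V}\mathrm{al}_\iota$, $\mathcal{F}_{\mathrm{te}}\cap\mathcal{F}_{\mathrm{th}}\subseteq\mathcal{V}\mathrm{al}$. Logical terms are terms of $\mathcal{T}(\mathcal{F}_{\mathrm{th}},\mathcal{V})$; a fixed interpretation $\mathcal{J}$ evaluates ground logical terms to values via $[\![f(t_1,\dots,t_n)]\!]=f_{\mathcal{J}}([\![t_1]\!],\dots,[\![t_n]\!])$. Constraints are logical terms of sort $\mathsf{bool}$ (with connectives, $\Rightarrow$, equality $=$). $\varphi$ is valid if $[\![\varphi\gamma]\!]=\top$ for all $\gamma$ mapping $\mathcal{V}\mathrm{ar}(\varphi)$ to values, satisfiable if this holds for some such $\gamma$; $\sigma\vDash\varphi$ means $\sigma(x)\in\mathcal{V}\mathrm{al}$ for $x\in\mathcal{V}\mathrm{ar}(\varphi)$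 and $\varphi\sigma$ valid. A constrained rewrite rule $\rho\colon\ell\to r\ [\varphi]$: $\ell,r$ terms of the same sort, $\mathrm{root}(\ell)\in\mathcal{F}_{\mathrm{te}}\setminus\mathcal{F}_{\mathrm{th}}$, $\varphi$ a constraint; $\mathcal{LV}\mathrm{ar}(\rho)=\mathcal{V}\mathrm{ar}(\varphi)\cup(\mathcal{V}\mathrm{ar}(r)\setminus\mathcal{V}\mathrm{ar}(\ell))$. An LCTRS $\mathcal{R}$ is a set of such rules. $\sigma\vDash\rho$ means $\mathcal{D}\mathrm{om}(\sigma)=\mathcal{V}\mathrm{ar}(\ell)\cup\mathcal{V}\mathrm{ar}(r)\cup\mathcal{V}\mathrm{ar}(\varphi)$, $\sigma(x)\in\mathcal{V}\mathrm{al}$ for $x\in\mathcal{LV}\mathrm{ar}(\rho)$, $\varphi\sigma$ valid. Calculation rules: $f(x_1,\dots,x_n)\to y\ [y=f(x_1,\dots,x_n)]$ for $f\in\mathcal{F}_{\mathrm{th}}\setminus\mathcal{V}\mathrm{al}$, $y$ fresh; $\mathcal{R}_{\mathrm{rc}}$ is $\mathcal{R}$ together with them. Multi-steps on terms: $x\xrightarrow{\circ}x$; $f(s_1,\dots,s_n)\xrightarrow{\circ}f(t_1,\dots,t_n)$ if $s_i\xrightarrow{\circ}t_i$ for all $i$; $\ell\sigma\xrightarrow{\circ}r\tau$ if $\rho\colon\ell\to r\ [\varphi]\in\mathcal{R}_{\mathrm{rc}}$, $\sigma\vDash\rho$ and $\sigma(x)\xrightarrow{\circ}\tau(x)$ for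 all $x\in\mathcal{D}\mathrm{om}(\sigma)$. Multi-steps on constrained terms $s\ [\varphi]$: $x\ [\varphi]\xrightarrow{\circ}x\ [\varphi]$ for variables $x$; $f(s_1,\dots,s_n)\ [\varphi]\xrightarrow{\circ}f(t_1,\dots,t_n)\ [\varphi]$ if $s_i\ [\varphi]\xrightarrow{\circ}t_i\ [\varphi]$ for all $i$; $\ell\sigma\ [\varphi]\xrightarrow{\circ}r\tau\ [\varphi]$ if $\rho\colon\ell\to r\ [\psi]\in\mathcal{R}_{\mathrm{rc}}$, $\sigma(x)\in\mathcal{V}\mathrm{al}\cup\mathcal{V}\mathrm{ar}(\varphi)$ for all $x\in\mathcal{LV}\mathrm{ar}(\rho)$, $\varphi$ satisfiable, $\varphi\Rightarrow\psi\sigma$ valid, and $\sigma(x)\ [\varphi]\xrightarrow{\circ}\tau(x)\ [\varphi]$ for all $x\in\mathcal{D}\mathrm{om}(\sigma)$. -}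

module Defs where

open import Data.Bool using (Bool; true; false; T; _∨_; if_then_else_)
open import Data.Unit using (⊤; tt)
open import Data.Empty using (⊥)
open import Data.Product using (Σ; Σ-syntax; _×_; _,_; proj₁; proj₂)
open import Data.Sum using (_⊎_)
open import Data.List using (List; []; _∷_)
open import Data.List.Membership.Propositional using (_∈_; _∉_)
open import Data.Maybe as Maybe using (Maybe; just; nothing; _>>=_)
open import Relation.Nullary using (¬_; yes; no)
open import Relation.Nullary.Decidable.Core using (T?)
open import Relation.Binary.PropositionalEquality using (_≡_; _≢_; subst)
open import Function.Bundles using (_⇔_)

-- The full signature  F = F_te ∪ F_th  is the type 'Fun' below: it
-- consists of user symbols 'sym s' (s : Sym, possibly infinitely many)
-- together with the built-in theory symbols the paper assumes to be
-- present in F_th: the boolean values ⊤ and ⊥ ('true'/'false'),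
-- implication '⇒' ('imp') and equality '=' on every sort ('eq ι').
-- Further connectives (∧, ¬, ...) may be supplied as user symbols.

record Signature : Set₁ where
  field
    Sort   : Set
    bool   : Sort
    Sym    : Set
    arS    : Sym → List Sort
    resS   : Sym → Sort
    isTeS  : Sym → Bool
    isThS  : Sym → Bool
    isValS : Sym → Bool
    cover      : ∀ s → T (isTeS s ∨ isThS s)
    te∩th⊆val  : ∀ s → T (isTeS s) → T (isThS s) → T (isValS s)
    val⇒th     : ∀ s → T (isValS s) → T (isThS s)
    valNullary : ∀ s → T (isValS s) → arS s ≡ []
    -- the boolean values are exactly ⊤ and ⊥
    valNotBool : ∀ s → T (isValS s) → resS s ≢ bool
    -- every (non-bool) theory sort has a value (bool has ⊤, ⊥)
    valNonEmpty : ∀ ι → ι ≢ bool → Σ[ s ∈ Sym ] (T (isValS s) × resS s ≡ ι)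
    -- infinitely many sorted variables (a fresh one of every sort)
    Var    : Set
    vsort  : Var → Sort
    fresh  : ∀ (ι : Sort) (xs : List Var) → Σ[ y ∈ Var ] (vsort y ≡ ι × y ∉ xs)

module Syntax (Sg : Signature) where
  open Signature Sg public

  data Fun : Set where
    sym   : Sym → Fun
    imp   : Fun
    eq    : Sort → Fun
    true  : Fun
    false : Fun

  ar : Fun → List Sort
  ar (sym s) = arS s
  ar imp     = bool ∷ bool ∷ []
  ar (eq ι)  = ι ∷ ι ∷ []
  ar true    = []
  ar false   = []

  res : Fun → Sort
  res (sym s) = resS s
  res imp     = bool
  res (eq _)  = bool
  res true    = bool
  res false   = bool

  isTh : Fun → Bool
  isTh (sym s) = isThS s
  isTh _       = true

  isTe : Fun → Bool
  isTe (sym s) = isTeS s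
  isTe _       = false

  isVal : Fun → Bool
  isVal (sym s) = isValS s
  isVal true    = true
  isVal false   = true
  isVal _       = false

  -- semantic values of a sort ι: the value symbols of sort ι
  ValS : Sort → Set
  ValS ι = Σ[ v ∈ Fun ] (T (isVal v) × res v ≡ ι)

  Vals : List Sort → Set
  Vals []       = ⊤
  Vals (ι ∷ ιs) = ValS ι × Vals ιs

  data Term : Sort → Set
  data Terms : List Sort → Set
  data Term where
    var : (x : Var) → Term (vsort x)
    app : (f : Fun) → Terms (ar f) → Term (res f)
  data Terms where
    []  : Terms []
    _∷_ : ∀ {ι ιs} → Term ι → Terms ιs → Terms (ι ∷ ιs)

  data _∈V_ (x : Var) : ∀ {ι} → Term ι → Set
  data _∈Vs_ (x : Var) : ∀ {ιs} → Terms ιs → Set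
  data _∈V_ x where
    here  : x ∈V var x
    inApp : ∀ {f ts} → x ∈Vs ts → x ∈V app f ts
  data _∈Vs_ x where
    hd : ∀ {ι ιs} {t : Term ι} {ts : Terms ιs} → x ∈V t → x ∈Vs (t ∷ ts)
    tl : ∀ {ι ιs} {t : Term ι} {ts : Terms ιs} → x ∈Vs ts → x ∈Vs (t ∷ ts)

  Subst : Set
  Subst = (x : Var) → Term (vsort x)

  _⟨_⟩  : ∀ {ι} → Term ι → Subst → Term ι
  _⟨_⟩* : ∀ {ιs} → Terms ιs → Subst → Terms ιs
  var x    ⟨ σ ⟩ = σ x
  app f ts ⟨ σ ⟩ = app f (ts ⟨ σ ⟩*)
  []       ⟨ σ ⟩* = []
  (t ∷ ts) ⟨ σ ⟩* = (t ⟨ σ ⟩) ∷ (ts ⟨ σ ⟩*)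

  data Logical : ∀ {ι} → Term ι → Set
  data Logicals : ∀ {ιs} → Terms ιs → Set
  data Logical where
    lvar : ∀ x → Logical (var x)
    lapp : ∀ {f ts} → T (isTh f) → Logicals ts → Logical (app f ts)
  data Logicals where
    []  : Logicals []
    _∷_ : ∀ {ι ιs} {t : Term ι} {ts : Terms ιs} → Logical t → Logicals ts → Logicals (t ∷ ts)

  IsConstraint : Term bool → Set
  IsConstraint φ = Logical φ

  isValT : ∀ {ι} → Term ι → Set
  isValT (var _)   = ⊥
  isValT (app f _) = T (isVal f)

  isVarOf : ∀ {ι} → Term bool → Term ι → Set
  isVarOf φ (var y)   = y ∈V φ
  isVarOf φ (app _ _) = ⊥

  _⇒ₜ_ : Term bool → Term bool → Term bool
  φ ⇒ₜ ψ = app imp (φ ∷ ψ ∷ [])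

  _=ₜ_ : ∀ {ι} → Term ι → Term ι → Term bool
  _=ₜ_ {ι} s t = app (eq ι) (s ∷ t ∷ [])

  RootOK : ∀ {ι} → Term ι → Set
  RootOK (var _)   = ⊥
  RootOK (app f _) = T (isTe f) × ¬ T (isTh f)

  record Rule : Set where
    constructor _⟶_[_]
    field
      {sort} : Sort
      lhs    : Term sort
      rhs    : Term sort
      guard  : Term bool
  open Rule public

  WFRule : Rule → Set
  WFRule ρ = RootOK (lhs ρ) × IsConstraint (guard ρ)

  _∈RV_ : Var → Rule → Set
  x ∈RV ρ = x ∈V lhs ρ ⊎ (x ∈V rhs ρ ⊎ x ∈V guard ρ)

  _∈LV_ : Var → Rule → Set
  x ∈LV ρ = x ∈V guard ρ ⊎ (x ∈V rhs ρ × ¬ (x ∈V lhs ρ))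

  data DistinctVars : ∀ {ιs} → Terms ιs → List Var → Set where
    []  : DistinctVars [] []
    _∷_ : ∀ {x ιs} {ts : Terms ιs} {ys} → x ∉ ys → DistinctVars ts ys →
          DistinctVars (var x ∷ ts) (x ∷ ys)

  data CalcRule : Rule → Set where
    calc : (f : Fun) → T (isTh f) → ¬ T (isVal f) →
           (us : Terms (ar f)) (xs : List Var) → DistinctVars us xs →
           (y : Var) → y ∉ xs → (p : vsort y ≡ res f) →
           CalcRule (app f us ⟶ subst Term p (var y)
                              [ subst Term p (var y) =ₜ app f us ])

record Interpretation (Sg : Signature) : Set where
  open Syntax Sg
  field
    interpS   : (s : Sym) → T (isThS s) → Vals (arS s) → ValS (resS s)
    interpVal : ∀ s (p : T (isThS s)) (vs : Vals (arS s)) →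
                T (isValS s) → proj₁ (interpS s p vs) ≡ sym s
    interpEq     : (ι : Sort) → ValS ι → ValS ι → Bool
    interpEq-def : ∀ ι (a b : ValS ι) → T (interpEq ι a b) ⇔ (proj₁ a ≡ proj₁ b)

record LCTRS (Sg : Signature) : Set₁ where
  open Syntax Sg
  field
    rules : Rule → Set
    wf    : ∀ ρ → rules ρ → WFRule ρ

module Rewriting (Sg : Signature) (J : Interpretation Sg) (R : LCTRS Sg) where
  open Syntax Sg public
  open Interpretation J public
  open LCTRS R public

  trueV : ValS bool
  trueV = true , tt , Relation.Binary.PropositionalEquality.refl

  falseV : ValS bool
  falseV = false , tt , Relation.Binary.PropositionalEquality.refl

  impV : ValS bool → ValS bool → ValS bool
  impV (true , _) b = b
  impV _          _ = trueV

  interp : (f : Fun) → T (isTh f) → Vals (ar f) → ValS (res f)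
  interp (sym s) p vs          = interpS s p vs
  interp imp     _ (a , b , _) = impV a b
  interp (eq ι)  _ (a , b , _) = if interpEq ι a b then trueV else falseV
  interp true    _ _           = trueV
  interp false   _ _           = falseV

  eval  : ∀ {ι} → Term ι → Maybe (ValS ι)
  evals : ∀ {ιs} → Terms ιs → Maybe (Vals ιs)
  eval (var x) = nothing
  eval (app f ts) with T? (isTh f)
  ... | yes p = Maybe.map (interp f p) (evals ts)
  ... | no _  = nothing
  evals [] = just tt
  evals (t ∷ ts) = eval t >>= λ v → Maybe.map (v ,_) (evals ts)

  Holds : Term bool → Set
  Holds φ = Maybe.map proj₁ (eval φ) ≡ just true

  ValuesOn : ∀ {ι} → Term ι → Subst → Set
  ValuesOn φ γ = ∀ x → x ∈V φ → isValT (γ x)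

  Valid : Term bool → Set
  Valid φ = ∀ γ → ValuesOn φ γ → Holds (φ ⟨ γ ⟩)

  Satisfiable : Term bool → Set
  Satisfiable φ = Σ[ γ ∈ Subst ] (ValuesOn φ γ × Holds (φ ⟨ γ ⟩))

  _⊨_ : Subst → Term bool → Set
  σ ⊨ φ = ValuesOn φ σ × Valid (φ ⟨ σ ⟩)

  -- σ ⊨ ρ  (the domain of σ being Var(ℓ) ∪ Var(r) ∪ Var(φ) is
  -- expressed by quantifying over exactly these variables below)
  _⊨R_ : Subst → Rule → Set
  σ ⊨R ρ = (∀ x → x ∈LV ρ → isValT (σ x)) × Valid (guard ρ ⟨ σ ⟩)

  Rrc : Rule → Set
  Rrc ρ = rules ρ ⊎ CalcRule ρ

  data _⇉_ : ∀ {ι} → Term ι → Term ι → Set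
  data _⇉*_ : ∀ {ιs} → Terms ιs → Terms ιs → Set
  data _⇉_ where
    mvar  : ∀ x → var x ⇉ var x
    mapp  : ∀ f {ss ts : Terms (ar f)} → ss ⇉* ts → app f ss ⇉ app f ts
    mrule : (ρ : Rule) → Rrc ρ → (σ τ : Subst) → σ ⊨R ρ →
            (∀ x → x ∈RV ρ → σ x ⇉ τ x) →
            (lhs ρ ⟨ σ ⟩) ⇉ (rhs ρ ⟨ τ ⟩)
  data _⇉*_ where
    []  : [] ⇉* []
    _∷_ : ∀ {ι ιs} {s t : Term ι} {ss ts : Terms ιs} →
          s ⇉ t → ss ⇉* ts → (s ∷ ss) ⇉* (t ∷ ts)

  data _⇉[_]_ : ∀ {ι} → Term ι → Term bool → Term ι → Set
  data _⇉*[_]_ : ∀ {ιs} → Terms ιs → Term bool → Terms ιs → Set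
  data _⇉[_]_ where
    cvar  : ∀ {φ} x → var x ⇉[ φ ] var x
    capp  : ∀ {φ} f {ss ts : Terms (ar f)} → ss ⇉*[ φ ] ts →
            app f ss ⇉[ φ ] app f ts
    crule : ∀ {φ} (ρ : Rule) → Rrc ρ → (σ τ : Subst) →
            (∀ x → x ∈LV ρ → isValT (σ x) ⊎ isVarOf φ (σ x)) →
            Satisfiable φ →
            Valid (φ ⇒ₜ (guard ρ ⟨ σ ⟩)) →
            (∀ x → x ∈RV ρ → σ x ⇉[ φ ] τ x) →
            (lhs ρ ⟨ σ ⟩) ⇉[ φ ] (rhs ρ ⟨ τ ⟩)
  data _⇉*[_]_ where
    []  : ∀ {φ} → [] ⇉*[ φ ] []
    _∷_ : ∀ {φ ι ιs} {s t : Term ι} {ss ts : Terms ιs} →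
          s ⇉[ φ ] t → ss ⇉*[ φ ] ts → (s ∷ ss) ⇉*[ φ ] (t ∷ ts)

-- A constrained step s [φ] ⇉ t [φ] instantiates the rule variables by
-- values or by variables of φ, and δ ⊨ φ sends the latter to values too.
-- So each rule application at substitution σ becomes, after δ, an
-- application at σδ: the logical variables still map to values, and the
-- guard holds because φδ is valid, φ ⇒ ψσ is valid and Var(ψσ) ⊆ Var(φ).
module Submission where

open import Defs
open import Data.Empty using (⊥-elim)
open import Data.Product using (Σ-syntax; _×_; _,_; proj₁; proj₂)
open import Data.Sum using (_⊎_; inj₁; inj₂)
open import Data.List using ([])
open import Data.Maybe using (just; nothing)
open import Relation.Nullary using (¬_)
open import Relation.Binary.PropositionalEquality as ≡
  using (_≡_; refl; cong; cong₂; subst; subst₂)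

module Substitution (Sg : Signature) where
  open Syntax Sg

  _∘ₛ_ : Subst → Subst → Subst
  (σ ∘ₛ δ) x = σ x ⟨ δ ⟩

  ⟨⟩-∘ₛ  : ∀ {ι} (t : Term ι) σ δ → t ⟨ σ ⟩ ⟨ δ ⟩ ≡ t ⟨ σ ∘ₛ δ ⟩
  ⟨⟩*-∘ₛ : ∀ {ιs} (ts : Terms ιs) σ δ → ts ⟨ σ ⟩* ⟨ δ ⟩* ≡ ts ⟨ σ ∘ₛ δ ⟩*
  ⟨⟩-∘ₛ (var x)    σ δ = refl
  ⟨⟩-∘ₛ (app f ts) σ δ = cong (app f) (⟨⟩*-∘ₛ ts σ δ)
  ⟨⟩*-∘ₛ []       σ δ = refl
  ⟨⟩*-∘ₛ (t ∷ ts) σ δ = cong₂ _∷_ (⟨⟩-∘ₛ t σ δ) (⟨⟩*-∘ₛ ts σ δ)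

  ∈V-⟨⟩  : ∀ {ι x} (t : Term ι) σ → x ∈V (t ⟨ σ ⟩) → Σ[ y ∈ Var ] (y ∈V t × x ∈V σ y)
  ∈Vs-⟨⟩ : ∀ {ιs x} (ts : Terms ιs) σ → x ∈Vs (ts ⟨ σ ⟩*) → Σ[ y ∈ Var ] (y ∈Vs ts × x ∈V σ y)
  ∈V-⟨⟩ (var y) σ x∈σy = y , here , x∈σy
  ∈V-⟨⟩ (app f ts) σ (inApp x∈) with ∈Vs-⟨⟩ ts σ x∈
  ... | y , y∈ts , x∈σy = y , inApp y∈ts , x∈σy
  ∈Vs-⟨⟩ (t ∷ ts) σ (hd x∈) with ∈V-⟨⟩ t σ x∈
  ... | y , y∈t , x∈σy = y , hd y∈t , x∈σy
  ∈Vs-⟨⟩ (t ∷ ts) σ (tl x∈) with ∈Vs-⟨⟩ ts σ x∈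
  ... | y , y∈ts , x∈σy = y , tl y∈ts , x∈σy

  ∉Vs-[] : ∀ {ιs x} {ts : Terms ιs} → ιs ≡ [] → ¬ x ∈Vs ts
  ∉Vs-[] () (hd _)
  ∉Vs-[] () (tl _)

  value⇒∉V : ∀ {ι x} (t : Term ι) → isValT t → ¬ x ∈V t
  value⇒∉V (app (sym s) ts) v (inApp x∈) = ∉Vs-[] (valNullary s v) x∈
  value⇒∉V (app true  _) _ (inApp ())
  value⇒∉V (app false _) _ (inApp ())

  value-⟨⟩ : ∀ {ι} (t : Term ι) γ → isValT t → isValT (t ⟨ γ ⟩)
  value-⟨⟩ (app f ts) γ v = v

  ∈V-valueOrVarOf : ∀ {ι x} {φ : Term bool} (u : Term ι) →
                    isValT u ⊎ isVarOf φ u → x ∈V u → x ∈V φ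
  ∈V-valueOrVarOf u (inj₁ v) x∈u = ⊥-elim (value⇒∉V u v x∈u)
  ∈V-valueOrVarOf (var z) (inj₂ z∈φ) here = z∈φ

module Instantiation (Sg : Signature) (J : Interpretation Sg) (R : LCTRS Sg) where
  open Rewriting Sg J R
  open Substitution Sg

  Holds-mp : ∀ a b → Holds a → Holds (a ⇒ₜ b) → Holds b
  Holds-mp a b ha h with eval a | eval b
  Holds-mp a b ha h | just (true , _) | just _  = h
  Holds-mp a b ha h | just (true , _) | nothing = h
  Holds-mp a b () h | just (sym _ , _)  | _
  Holds-mp a b () h | just (imp , _)    | _
  Holds-mp a b () h | just (eq _ , _)   | _
  Holds-mp a b () h | just (false , _)  | _
  Holds-mp a b () h | nothing           | _

  ⇉-refl  : ∀ {ι} (t : Term ι) → t ⇉ t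
  ⇉*-refl : ∀ {ιs} (ts : Terms ιs) → ts ⇉* ts
  ⇉-refl (var x)    = mvar x
  ⇉-refl (app f ts) = mapp f (⇉*-refl ts)
  ⇉*-refl []       = []
  ⇉*-refl (t ∷ ts) = ⇉-refl t ∷ ⇉*-refl ts

  valueOrVarOf-⟨⟩ : ∀ {ι} {φ : Term bool} {δ} (u : Term ι) → ValuesOn φ δ →
                    isValT u ⊎ isVarOf φ u → isValT (u ⟨ δ ⟩)
  valueOrVarOf-⟨⟩ u _ (inj₁ v) = value-⟨⟩ u _ v
  valueOrVarOf-⟨⟩ (var z) δ-val (inj₂ z∈φ) = δ-val z z∈φ

  ⊨⇒ground : ∀ {φ : Term bool} {δ x} → ValuesOn φ δ → ¬ x ∈V (φ ⟨ δ ⟩)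
  ⊨⇒ground {φ} {δ} δ-val x∈ with ∈V-⟨⟩ φ δ x∈
  ... | y , y∈φ , x∈δy = value⇒∉V (δ y) (δ-val y y∈φ) x∈δy

  Valid-⇒-⟨⟩ : ∀ {φ ψ : Term bool} {δ} → δ ⊨ φ → (∀ x → x ∈V ψ → x ∈V φ) →
               Valid (φ ⇒ₜ ψ) → Valid (ψ ⟨ δ ⟩)
  Valid-⇒-⟨⟩ {φ} {ψ} {δ} (δ-val , φδ-valid) ψ⊆φ φ⇒ψ γ _ =
    subst Holds (≡.sym (⟨⟩-∘ₛ ψ δ γ))
      (Holds-mp (φ ⟨ δ ∘ₛ γ ⟩) (ψ ⟨ δ ∘ₛ γ ⟩) φ-holds (φ⇒ψ (δ ∘ₛ γ) δγ-val))
    where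
      φ-holds : Holds (φ ⟨ δ ∘ₛ γ ⟩)
      φ-holds = subst Holds (⟨⟩-∘ₛ φ δ γ)
                  (φδ-valid γ λ x x∈ → ⊥-elim (⊨⇒ground δ-val x∈))
      δγ-val : ValuesOn (φ ⇒ₜ ψ) (δ ∘ₛ γ)
      δγ-val x (inApp (hd x∈φ))      = value-⟨⟩ (δ x) γ (δ-val x x∈φ)
      δγ-val x (inApp (tl (hd x∈ψ))) = value-⟨⟩ (δ x) γ (δ-val x (ψ⊆φ x x∈ψ))

  module _ (φ : Term bool) (δ : Subst) (δ⊨φ : δ ⊨ φ) where
    ⇉[]⇒⇉  : ∀ {ι} {s t : Term ι} → s ⇉[ φ ] t → (s ⟨ δ ⟩) ⇉ (t ⟨ δ ⟩)
    ⇉*[]⇒⇉* : ∀ {ιs} {ss ts : Terms ιs} → ss ⇉*[ φ ] ts → (ss ⟨ δ ⟩*) ⇉* (ts ⟨ δ ⟩*)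
    ⇉[]⇒⇉ (cvar x)      = ⇉-refl (δ x)
    ⇉[]⇒⇉ (capp f steps) = mapp f (⇉*[]⇒⇉* steps)
    ⇉[]⇒⇉ (crule ρ ρ∈R σ τ lv _ φ⇒guard steps) =
      subst₂ _⇉_ (≡.sym (⟨⟩-∘ₛ (lhs ρ) σ δ)) (≡.sym (⟨⟩-∘ₛ (rhs ρ) τ δ))
        (mrule ρ ρ∈R (σ ∘ₛ δ) (τ ∘ₛ δ) (lv-val , guard-valid)
               (λ x x∈ρ → ⇉[]⇒⇉ (steps x x∈ρ)))
      where
        lv-val : ∀ x → x ∈LV ρ → isValT ((σ ∘ₛ δ) x)
        lv-val x x∈ = valueOrVarOf-⟨⟩ (σ x) (proj₁ δ⊨φ) (lv x x∈)
        guardσ⊆φ : ∀ x → x ∈V (guard ρ ⟨ σ ⟩) → x ∈V φ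
        guardσ⊆φ x x∈ with ∈V-⟨⟩ (guard ρ) σ x∈
        ... | y , y∈guard , x∈σy = ∈V-valueOrVarOf (σ y) (lv y (inj₁ y∈guard)) x∈σy
        guard-valid : Valid (guard ρ ⟨ σ ∘ₛ δ ⟩)
        guard-valid = subst Valid (⟨⟩-∘ₛ (guard ρ) σ δ)
                        (Valid-⇒-⟨⟩ δ⊨φ guardσ⊆φ φ⇒guard)
    ⇉*[]⇒⇉* []       = []
    ⇉*[]⇒⇉* (d ∷ ds) = ⇉[]⇒⇉ d ∷ ⇉*[]⇒⇉* ds

lemma10 : (Sg : Signature) (J : Interpretation Sg) (R : LCTRS Sg) →
    let open Rewriting Sg J R in
    ∀ {ι} (s t : Term ι) (φ : Term bool) → IsConstraint φ →
    s ⇉[ φ ] t → (δ : Subst) → δ ⊨ φ → (s ⟨ δ ⟩) ⇉ (t ⟨ δ ⟩)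
lemma10 Sg J R s t φ _ step δ δ⊨φ = Instantiation.⇉[]⇒⇉ Sg J R φ δ δ⊨φ step
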